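{- Let $w$ be a saturated set of formulas of $\mathcal{L}_{\mathsf{DPL}}$. Then (1) $w$ is closed under deduction in $\mathcal{H}_{\mathsf{DPL}}$: for every formula $\varphi$, if $w\vdash\varphi$ in $\mathcal{H}_{\mathsf{DPL}}$ then $\varphi\in w$; and (2) $w$ is consistent in $\mathcal{H}_{\mathsf{DPL}}$.
   Context: Let $\mathbb{P}$ be a countable set of propositional variables. The formulas of $\mathcal{L}_{\mathsf{DPL}}$ are given by $\varphi ::= p \mid \neg\varphi \mid \varphi\wedge\varphi \mid L_r\varphi \mid \bigcirc\varphi$ with $p\in\mathbb{P}$, $r\in\mathbb{Q}\cap[0,1]$; $\bigcirc^n$ is $n$-fold iteration of $\bigcirc$; $L_{r_1}\cdots L_{r_k}L_s\varphi$ denotes iterated application ($k\ge 0$). The Hilbert system $\mathcal{H}_{\mathsf{DPL}}$ has the axiom schemes: propositional tautologies; $L_0\bot$; $L_r\neg\varphi\to\neg L_s\varphi$ if $r+s>1$; $L_r(\varphi\wedge\psi)\wedge L_s(\varphi\wedge\neg\psi)\to L_{r+s}\varphi$ if $r+s\le 1$; $\neg L_r(\varphi\wedge\psi)\wedge\neg L_s(\varphi\wedge\neg\psi)\to\neg L_{r+s}\varphi$ if $r+s\le1$; $L_1(\varphi\to\psi)\to(L_r\varphi\to L_r\psi)$; $\bigcirc\neg\varphi\leftrightarrow\neg\bigcirc\varphi$; $\bigcirc(\varphi\wedge\psi)\leftrightarrow(\bigcirc\varphi\wedge\bigcirc\psi)$; and rules: modus ponens; the generalized Archimedean rule: for $n,k\in\mathbb{N}$,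 $r_1,\dots,r_k,r\in\mathbb{Q}\cap[0,1]$, from $\{\psi\to\bigcirc^nL_{r_1}\cdots L_{r_k}L_s\varphi\mid s<r,\ s\in\mathbb{Q}\cap[0,1]\}$ infer $\psi\to\bigcirc^nL_{r_1}\cdots L_{r_k}L_r\varphi$; from $\varphi$ infer $L_1\varphi$; from $\varphi$ infer $\bigcirc\varphi$. A theorem is the last element of a sequence $(\varphi_\beta)_{\beta\le\alpha+1}$ ($\alpha$ a countable ordinal) each element an axiom or obtained by a rule from earlier elements; $\Gamma\vdash\varphi$ means such a sequence ending in $\varphi$ each element of which is in $\Gamma$, a theorem, or obtained from earlier elements by a rule other than the two necessitation rules. $\Gamma$ is consistent if $\Gamma\nvdash\bot$, finitely consistent if each finite subset is consistent. A set $w$ of formulas is saturated if (i) $w$ is finitely consistent, (ii) for every formula $\varphi$, $\varphi\in w$ or $\neg\varphi\in w$, and (iii) for all $\varphi$, $n,k\in\mathbb{N}$, $r_1,\dots,r_k,r\in\mathbb{Q}\cap[0,1]$: if $\bigcirc^nL_{r_1}\cdots L_{r_k}L_s\varphi\in w$ for all rational $s<r$, then $\bigcirc^nL_{r_1}\cdots L_{r_k}L_r\varphi\in w$. -}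

module Defs where

open import Data.Nat using (ℕ)
open import Data.Bool using (Bool; true; false; not; _∧_)
open import Data.List using (List; []; _∷_)
open import Data.List.Membership.Propositional using (_∈_)
open import Data.List.Relation.Unary.All using (All)
open import Data.Product using (_×_)
open import Data.Empty using (⊥)
open import Data.Sum using (_⊎_)
open import Relation.Nullary using (¬_)
open import Relation.Binary.PropositionalEquality using (_≡_; sym)
open import Data.Rational using (ℚ; 0ℚ; 1ℚ; _+_; _≤_; _<_; _>_)
open import Data.Rational.Properties using (nonNegative⁻¹; ≤-refl; ≤-trans; ≤-reflexive; +-mono-≤; +-identityʳ)

-- Rationals in [0,1] (bounds are proof-irrelevant, so two elements with
-- the same value are definitionally equal).

record ℚ₀₁ : Set where
  constructor ⟨_⟩
  field
    val : ℚ
    .{lo} : 0ℚ ≤ val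
    .{hi} : val ≤ 1ℚ
open ℚ₀₁ public

zeroQ : ℚ₀₁
zeroQ = record { val = 0ℚ ; lo = ≤-refl ; hi = nonNegative⁻¹ _ }

oneQ : ℚ₀₁
oneQ = record { val = 1ℚ ; lo = nonNegative⁻¹ _ ; hi = ≤-refl }

addQ : (r s : ℚ₀₁) → .(val r + val s ≤ 1ℚ) → ℚ₀₁
addQ (⟨ r ⟩ {r0} {r1}) (⟨ s ⟩ {s0} {s1}) h = record
  { val = r + s
  ; lo  = ≤-trans (≤-reflexive (sym (+-identityʳ 0ℚ))) (+-mono-≤ r0 s0)
  ; hi  = h }

infix 8 ¬f_
infixr 6 _∧f_
infix 3 _⇔_
data Form : Set where
  var   : ℕ → Form
  ¬f_   : Form → Form
  _∧f_  : Form → Form → Form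
  L     : ℚ₀₁ → Form → Form
  ○     : Form → Form

⊥f : Form
⊥f = var 0 ∧f ¬f var 0

infixr 4 _⇒_
_⇒_ : Form → Form → Form
φ ⇒ ψ = ¬f (φ ∧f ¬f ψ)

_⇔_ : Form → Form → Form
φ ⇔ ψ = (φ ⇒ ψ) ∧f (ψ ⇒ φ)

○^ : ℕ → Form → Form
○^ ℕ.zero φ = φ
○^ (ℕ.suc n) φ = ○ (○^ n φ)

Ls : List ℚ₀₁ → Form → Form
Ls [] φ = φ
Ls (r ∷ rs) φ = L r (Ls rs φ)

-- Propositional tautologies: true under every Boolean valuation of the
-- propositionally atomic formulas (variables, L_r ψ, ○ ψ).

eval : (Form → Bool) → Form → Bool
eval v (var p)  = v (var p)
eval v (¬f φ)   = not (eval v φ)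
eval v (φ ∧f ψ) = eval v φ ∧ eval v ψ
eval v (L r φ)  = v (L r φ)
eval v (○ φ)    = v (○ φ)

Tautology : Form → Set
Tautology φ = (v : Form → Bool) → eval v φ ≡ true

data Axiom : Form → Set where
  taut  : ∀ {φ} → Tautology φ → Axiom φ
  L0⊥   : Axiom (L zeroQ ⊥f)
  ax-neg : ∀ r s φ → val r + val s > 1ℚ → Axiom (L r (¬f φ) ⇒ ¬f L s φ)
  ax-add : ∀ r s φ ψ → (h : val r + val s ≤ 1ℚ) →
           Axiom ((L r (φ ∧f ψ) ∧f L s (φ ∧f ¬f ψ)) ⇒ L (addQ r s h) φ)
  ax-add¬ : ∀ r s φ ψ → (h : val r + val s ≤ 1ℚ) →
           Axiom ((¬f L r (φ ∧f ψ) ∧f ¬f L s (φ ∧f ¬f ψ)) ⇒ ¬f L (addQ r s h) φ)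
  ax-K  : ∀ r φ ψ → Axiom (L oneQ (φ ⇒ ψ) ⇒ (L r φ ⇒ L r ψ))
  ax-○¬ : ∀ φ → Axiom (○ (¬f φ) ⇔ ¬f ○ φ)
  ax-○∧ : ∀ φ ψ → Axiom (○ (φ ∧f ψ) ⇔ (○ φ ∧f ○ ψ))

-- Theorems (inductively generated; equivalent to derivations as
-- sequences of countable-ordinal length).

data Thm : Form → Set where
  axiom : ∀ {φ} → Axiom φ → Thm φ
  mp    : ∀ {φ ψ} → Thm φ → Thm (φ ⇒ ψ) → Thm ψ
  arch  : ∀ ψ n rs r φ →
          ((s : ℚ₀₁) → val s < val r → Thm (ψ ⇒ ○^ n (Ls rs (L s φ)))) →
          Thm (ψ ⇒ ○^ n (Ls rs (L r φ)))
  necL  : ∀ {φ} → Thm φ → Thm (L oneQ φ)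
  nec○  : ∀ {φ} → Thm φ → Thm (○ φ)

-- Deduction from a set Γ (necessitation rules not applied to Γ-steps).
infix 3 _⊢_
data _⊢_ (Γ : Form → Set) : Form → Set where
  hyp  : ∀ {φ} → Γ φ → Γ ⊢ φ
  thm  : ∀ {φ} → Thm φ → Γ ⊢ φ
  mp   : ∀ {φ ψ} → Γ ⊢ φ → Γ ⊢ (φ ⇒ ψ) → Γ ⊢ ψ
  arch : ∀ ψ n rs r φ →
         ((s : ℚ₀₁) → val s < val r → Γ ⊢ (ψ ⇒ ○^ n (Ls rs (L s φ)))) →
         Γ ⊢ (ψ ⇒ ○^ n (Ls rs (L r φ)))

Consistent : (Form → Set) → Set
Consistent Γ = ¬ (Γ ⊢ ⊥f)

FinitelyConsistent : (Form → Set) → Set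
FinitelyConsistent Γ = (Δ : List Form) → All Γ Δ → Consistent (λ φ → φ ∈ Δ)

record Saturated (w : Form → Set) : Set where
  field
    finCons  : FinitelyConsistent w
    complete : (φ : Form) → w φ ⊎ w (¬f φ)
    archClosed : ∀ φ n rs r →
      ((s : ℚ₀₁) → val s < val r → w (○^ n (Ls rs (L s φ)))) →
      w (○^ n (Ls rs (L r φ)))

-- A complete, finitely consistent w contains every formula derivable from
-- finitely many of its members: otherwise the negation lies in w and together
-- with those members derives ⊥. This gives closure under theorems and modus
-- ponens; the Archimedean rule is matched by the Archimedean closure of w,
-- after splitting on whether its antecedent lies in w.
module Submission where

open import Defs
open import Data.Product using (_×_; _,_)
open import Data.Bool using (true; false)
open import Data.List using (List; []; _∷_)
open import Data.List.Membership.Propositional using (_∈_)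
open import Data.List.Relation.Unary.Any using (here; there)
open import Data.List.Relation.Unary.All using (All; []; _∷_)
open import Data.Sum using (inj₁; inj₂)
open import Data.Empty using (⊥-elim)
open import Relation.Binary.PropositionalEquality using (_≡_; refl)

⊢-mono : ∀ {Γ Δ : Form → Set} → (∀ {φ} → Γ φ → Δ φ) → ∀ {φ} → Γ ⊢ φ → Δ ⊢ φ
⊢-mono Γ⊆Δ (hyp p)              = hyp (Γ⊆Δ p)
⊢-mono Γ⊆Δ (thm t)              = thm t
⊢-mono Γ⊆Δ (mp d e)             = mp (⊢-mono Γ⊆Δ d) (⊢-mono Γ⊆Δ e)
⊢-mono Γ⊆Δ (arch ψ n rs r φ ds) = arch ψ n rs r φ (λ s s<r → ⊢-mono Γ⊆Δ (ds s s<r))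

eval-⊥f : ∀ v → eval v ⊥f ≡ false
eval-⊥f v with v (var 0)
... | true  = refl
... | false = refl

noncontradiction-taut : ∀ φ → Tautology (φ ⇒ ¬f φ ⇒ ⊥f)
noncontradiction-taut φ v rewrite eval-⊥f v with eval v φ
... | true  = refl
... | false = refl

explosion-taut : ∀ φ ψ → Tautology (¬f φ ⇒ φ ⇒ ψ)
explosion-taut φ ψ v with eval v φ
... | true  = refl
... | false = refl

weakening-taut : ∀ φ ψ → Tautology (ψ ⇒ φ ⇒ ψ)
weakening-taut φ ψ v with eval v φ | eval v ψ
... | true  | true  = refl
... | true  | false = refl
... | false | true  = refl
... | false | false = refl

module _ {w : Form → Set} (S : Saturated w) where
  open Saturated S

  ∈-if-finitely-derivable : ∀ {φ} (Δ : List Form) → All w Δ → (λ ψ → ψ ∈ Δ) ⊢ φ → w φ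
  ∈-if-finitely-derivable {φ} Δ Δ⊆w d with complete φ
  ... | inj₁ φ∈w  = φ∈w
  ... | inj₂ ¬φ∈w = ⊥-elim (finCons (¬f φ ∷ Δ) (¬φ∈w ∷ Δ⊆w)
          (mp (hyp (here refl))
              (mp (⊢-mono there d) (thm (axiom (taut (noncontradiction-taut φ)))))))

  thm-∈ : ∀ {φ} → Thm φ → w φ
  thm-∈ t = ∈-if-finitely-derivable [] [] (thm t)

  mp-∈ : ∀ {φ ψ} → w φ → w (φ ⇒ ψ) → w ψ
  mp-∈ {φ} {ψ} φ∈w φ⇒ψ∈w = ∈-if-finitely-derivable (φ ∷ (φ ⇒ ψ) ∷ []) (φ∈w ∷ φ⇒ψ∈w ∷ [])
    (mp (hyp (here refl)) (hyp (there (here refl))))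

  taut-∈ : ∀ {φ ψ} → Tautology (φ ⇒ ψ) → w φ → w ψ
  taut-∈ τ φ∈w = mp-∈ φ∈w (thm-∈ (axiom (taut τ)))

  ⊢⇒∈ : ∀ {φ} → w ⊢ φ → w φ
  ⊢⇒∈ (hyp φ∈w) = φ∈w
  ⊢⇒∈ (thm t)   = thm-∈ t
  ⊢⇒∈ (mp d e)  = mp-∈ (⊢⇒∈ d) (⊢⇒∈ e)
  ⊢⇒∈ (arch ψ n rs r φ ds) with complete ψ
  ... | inj₂ ¬ψ∈w = taut-∈ (explosion-taut ψ (○^ n (Ls rs (L r φ)))) ¬ψ∈w
  ... | inj₁ ψ∈w  = taut-∈ (weakening-taut ψ (○^ n (Ls rs (L r φ))))
          (archClosed φ n rs r (λ s s<r → mp-∈ ψ∈w (⊢⇒∈ (ds s s<r))))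

  consistent : Consistent w
  consistent d = finCons (⊥f ∷ []) (⊢⇒∈ d ∷ []) (hyp (here refl))

proposition3p6 : (w : Form → Set) → Saturated w →
    ((φ : Form) → w ⊢ φ → w φ) × Consistent w
proposition3p6 w S = (λ φ → ⊢⇒∈ S) , consistent S
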